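{- Working in ZFC as metatheory and assuming ZFC is consistent, for all integers $n,m\geq1$ the formula $WO^1$ is HPL-independent of $choice_h^{n,m}$: there is a Henkin structure of second order that is a model of $choice_h^{n,m}\cup\{WO^1\}$, and there is a Henkin structure of second order that is a model of $choice_h^{n,m}\cup\{\neg WO^1\}$.
   Context: Second-order language: many-sorted first-order language with identity, individual variables (sort $0$), predicate variables of each sort $n\ge1$, atomic formulas $x_i=x_j$, $A=B$ (same sort), $Ax_1\cdots x_n$; closed under connectives and quantifiers over both kinds. A predicate structure $(J_n)_{n\ge0}$: nonempty individual domain $J_0$ and for each $n\ge1$ a nonempty set $J_n$ of $n$-ary predicates (functions $J_0^n\to\{true,false\}$); sort-$n$ variables range over $J_n$, $Ax_1\cdots x_n$ true iff the assigned predicate is true at the assigned tuple, $=$ is real equality. A Henkin structure is a predicate structure satisfying all comprehension axioms $\exists A\forall x_1\cdots\forall x_n(Ax_1\cdots x_n\leftrightarrow H)$ ($A$ not occurring in $H$). $choice_h^{n,m}$ is the set of all formulas $choice_h^{n,m}(H)=\forall\mathbf{x}\exists D\,H(\mathbf{x},D)\to\exists S\forall\mathbf{x}\exists D(\forall\mathbf{y}(D\mathbf{y}\leftrightarrow S\mathbf{x}\mathbf{y})\wedge H(\mathbf{x},D))$, with $\mathbf{x}=x_1,\ldots,x_n$, $\mathbf{y}=y_1,\ldots,y_m$, $D$ of sort $m$, $S$ of sort $n+m$, and $H$ any formula in which at most $x_1,\ldots,x_n,D$ occur free (and only free). $WO^1$ is the second-order well-ordering principle for unary predicates: for every unary $A$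 there is a binary $T$ linearly ordering $A$ such that every unary $B$ with $\exists xBx$ and $\forall x(Bx\to Ax)$ has a $T$-least element. A formula is HPL-independent of a set of formulas $\Gamma$ if neither it nor its negation holds in all Henkin structures that are models of $\Gamma$. -}

module Defs where

open import Data.Nat using (ℕ; zero; suc; _+_; _≟_)
open import Data.Bool using (Bool; true)
open import Data.Fin using (Fin)
open import Data.Vec using (Vec; lookup; map; _++_; _∷_; [])
open import Data.Product using (Σ; Σ-syntax; _×_; _,_; proj₁)
open import Data.Sum using (_⊎_)
open import Data.Empty using (⊥)
open import Relation.Nullary using (¬_; yes; no)
open import Relation.Binary.PropositionalEquality using (_≡_; refl)

-- Predicate variables of sort (suc k) (i.e. arity k+1 ≥ 1) are A^k_i, i : ℕ.

data Formula : Set where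
  eqI  : ℕ → ℕ → Formula
  eqP  : (k : ℕ) → ℕ → ℕ → Formula
  atom : (k : ℕ) → ℕ → Vec ℕ (suc k) → Formula
  ¬'   : Formula → Formula
  _∧'_ : Formula → Formula → Formula
  _∨'_ : Formula → Formula → Formula
  _⇒'_ : Formula → Formula → Formula
  _⇔'_ : Formula → Formula → Formula
  ∀i   : ℕ → Formula → Formula
  ∃i   : ℕ → Formula → Formula
  ∀p   : (k : ℕ) → ℕ → Formula → Formula
  ∃p   : (k : ℕ) → ℕ → Formula → Formula

infixr 6 _∧'_ _∨'_
infixr 5 _⇒'_ _⇔'_

∀i* : {n : ℕ} → Vec ℕ n → Formula → Formula
∀i* []       φ = φ
∀i* (x ∷ xs) φ = ∀i x (∀i* xs φ)

FreeI : ℕ → Formula → Set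
FreeI i (eqI a b)     = (i ≡ a) ⊎ (i ≡ b)
FreeI i (eqP k a b)   = ⊥
FreeI i (atom k a xs) = Σ[ j ∈ Fin (suc k) ] lookup xs j ≡ i
FreeI i (¬' φ)        = FreeI i φ
FreeI i (φ ∧' ψ)      = FreeI i φ ⊎ FreeI i ψ
FreeI i (φ ∨' ψ)      = FreeI i φ ⊎ FreeI i ψ
FreeI i (φ ⇒' ψ)      = FreeI i φ ⊎ FreeI i ψ
FreeI i (φ ⇔' ψ)      = FreeI i φ ⊎ FreeI i ψ
FreeI i (∀i x φ)      = ¬ (i ≡ x) × FreeI i φ
FreeI i (∃i x φ)      = ¬ (i ≡ x) × FreeI i φ
FreeI i (∀p k a φ)    = FreeI i φ
FreeI i (∃p k a φ)    = FreeI i φ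

BoundI : ℕ → Formula → Set
BoundI i (eqI a b)     = ⊥
BoundI i (eqP k a b)   = ⊥
BoundI i (atom k a xs) = ⊥
BoundI i (¬' φ)        = BoundI i φ
BoundI i (φ ∧' ψ)      = BoundI i φ ⊎ BoundI i ψ
BoundI i (φ ∨' ψ)      = BoundI i φ ⊎ BoundI i ψ
BoundI i (φ ⇒' ψ)      = BoundI i φ ⊎ BoundI i ψ
BoundI i (φ ⇔' ψ)      = BoundI i φ ⊎ BoundI i ψ
BoundI i (∀i x φ)      = (i ≡ x) ⊎ BoundI i φ
BoundI i (∃i x φ)      = (i ≡ x) ⊎ BoundI i φ
BoundI i (∀p k a φ)    = BoundI i φ
BoundI i (∃p k a φ)    = BoundI i φ

FreeP : ℕ → ℕ → Formula → Set
FreeP k i (eqI a b)      = ⊥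
FreeP k i (eqP l a b)    = (k ≡ l × i ≡ a) ⊎ (k ≡ l × i ≡ b)
FreeP k i (atom l a xs)  = k ≡ l × i ≡ a
FreeP k i (¬' φ)         = FreeP k i φ
FreeP k i (φ ∧' ψ)       = FreeP k i φ ⊎ FreeP k i ψ
FreeP k i (φ ∨' ψ)       = FreeP k i φ ⊎ FreeP k i ψ
FreeP k i (φ ⇒' ψ)       = FreeP k i φ ⊎ FreeP k i ψ
FreeP k i (φ ⇔' ψ)       = FreeP k i φ ⊎ FreeP k i ψ
FreeP k i (∀i x φ)       = FreeP k i φ
FreeP k i (∃i x φ)       = FreeP k i φ
FreeP k i (∀p l a φ)     = ¬ (k ≡ l × i ≡ a) × FreeP k i φ
FreeP k i (∃p l a φ)     = ¬ (k ≡ l × i ≡ a) × FreeP k i φ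

BoundP : ℕ → ℕ → Formula → Set
BoundP k i (eqI a b)      = ⊥
BoundP k i (eqP l a b)    = ⊥
BoundP k i (atom l a xs)  = ⊥
BoundP k i (¬' φ)         = BoundP k i φ
BoundP k i (φ ∧' ψ)       = BoundP k i φ ⊎ BoundP k i ψ
BoundP k i (φ ∨' ψ)       = BoundP k i φ ⊎ BoundP k i ψ
BoundP k i (φ ⇒' ψ)       = BoundP k i φ ⊎ BoundP k i ψ
BoundP k i (φ ⇔' ψ)       = BoundP k i φ ⊎ BoundP k i ψ
BoundP k i (∀i x φ)       = BoundP k i φ
BoundP k i (∃i x φ)       = BoundP k i φ
BoundP k i (∀p l a φ)     = (k ≡ l × i ≡ a) ⊎ BoundP k i φ
BoundP k i (∃p l a φ)     = (k ≡ l × i ≡ a) ⊎ BoundP k i φ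

OccursP : ℕ → ℕ → Formula → Set
OccursP k i φ = FreeP k i φ ⊎ BoundP k i φ

Distinct : {n : ℕ} → Vec ℕ n → Set
Distinct {n} v = (p q : Fin n) → lookup v p ≡ lookup v q → p ≡ q

Pred : Set → ℕ → Set
Pred D k = Vec D (suc k) → Bool

record PredStructure : Set₁ where
  field
    J₀   : Set
    j₀   : J₀
    J    : (k : ℕ) → Pred J₀ k → Set  -- J_{k+1} as a set of (k+1)-ary predicates
    Jne  : (k : ℕ) → Σ (Pred J₀ k) (J k)

module _ (M : PredStructure) where
  open PredStructure M

  JElt : ℕ → Set
  JElt k = Σ (Pred J₀ k) (J k)

  record Assignment : Set where
    field
      ind  : ℕ → J₀
      prd  : (k i : ℕ) → JElt k

  open Assignment

  updI : Assignment → ℕ → J₀ → Assignment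
  updI ρ x d = record { ind = f ; prd = prd ρ }
    where
    f : ℕ → J₀
    f i with i ≟ x
    ... | yes _ = d
    ... | no  _ = ind ρ i

  updP : Assignment → (k : ℕ) → ℕ → JElt k → Assignment
  updP ρ k a P = record { ind = ind ρ ; prd = g }
    where
    g : (l i : ℕ) → JElt l
    g l i with k ≟ l | a ≟ i
    ... | yes refl | yes _ = P
    ... | _        | _     = prd ρ l i

  -- satisfaction (equality of predicates is real, i.e. extensional, equality)
  Sat : Formula → Assignment → Set
  Sat (eqI a b)     ρ = ind ρ a ≡ ind ρ b
  Sat (eqP k a b)   ρ = (v : Vec J₀ (suc k)) → proj₁ (prd ρ k a) v ≡ proj₁ (prd ρ k b) v
  Sat (atom k a xs) ρ = proj₁ (prd ρ k a) (map (ind ρ) xs) ≡ true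
  Sat (¬' φ)        ρ = ¬ Sat φ ρ
  Sat (φ ∧' ψ)      ρ = Sat φ ρ × Sat ψ ρ
  Sat (φ ∨' ψ)      ρ = Sat φ ρ ⊎ Sat ψ ρ
  Sat (φ ⇒' ψ)      ρ = Sat φ ρ → Sat ψ ρ
  Sat (φ ⇔' ψ)      ρ = (Sat φ ρ → Sat ψ ρ) × (Sat ψ ρ → Sat φ ρ)
  Sat (∀i x φ)      ρ = (d : J₀) → Sat φ (updI ρ x d)
  Sat (∃i x φ)      ρ = Σ[ d ∈ J₀ ] Sat φ (updI ρ x d)
  Sat (∀p k a φ)    ρ = (P : JElt k) → Sat φ (updP ρ k a P)
  Sat (∃p k a φ)    ρ = Σ[ P ∈ JElt k ] Sat φ (updP ρ k a P)

  Holds : Formula → Set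
  Holds φ = (ρ : Assignment) → Sat φ ρ

  ModelOf : (Formula → Set) → Set
  ModelOf Γ = (φ : Formula) → Γ φ → Holds φ

Comprehension : Formula → Set
Comprehension φ =
  Σ[ k ∈ ℕ ] Σ[ a ∈ ℕ ] Σ[ xs ∈ Vec ℕ (suc k) ] Σ[ H ∈ Formula ]
    Distinct xs × ¬ OccursP k a H ×
    (φ ≡ ∃p k a (∀i* xs (atom k a xs ⇔' H)))

IsHenkin : PredStructure → Set
IsHenkin M = ModelOf M Comprehension

-- The schema choice_h^{n,m}, for n = suc a, m = suc b:
--   ∀x ∃D H(x,D) → ∃S ∀x ∃D (∀y (D y ↔ S x y) ∧ H(x,D))
-- D of sort m (index b), S of sort n+m (index a + suc b);
-- x, y distinct individual variables; in H at most x, D occur free,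
-- and x, D occur only free (they are not bound in H).

choiceFormula : (a b : ℕ) → Vec ℕ (suc a) → Vec ℕ (suc b) → ℕ → ℕ → Formula → Formula
choiceFormula a b xs ys d s H =
  ∀i* xs (∃p b d H) ⇒'
  ∃p (a + suc b) s (∀i* xs (∃p b d
      (∀i* ys (atom b d ys ⇔' atom (a + suc b) s (xs ++ ys)) ∧' H)))

ChoiceH : (n m : ℕ) → Formula → Set
ChoiceH (suc a) (suc b) φ =
  Σ[ xs ∈ Vec ℕ (suc a) ] Σ[ ys ∈ Vec ℕ (suc b) ] Σ[ d ∈ ℕ ] Σ[ s ∈ ℕ ] Σ[ H ∈ Formula ]
    Distinct (xs ++ ys) ×
    ((i : ℕ) → FreeI i H → Σ[ j ∈ Fin (suc a) ] lookup xs j ≡ i) ×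
    ((k i : ℕ) → FreeP k i H → (k ≡ b × i ≡ d)) ×
    ((j : Fin (suc a)) → ¬ BoundI (lookup xs j) H) ×
    ¬ BoundP b d H ×
    (φ ≡ choiceFormula a b xs ys d s H)
ChoiceH _ _ φ = ⊥

-- WO^1 (variables: A = A^0_0 unary, T = A^1_0 binary, B = A^0_1 unary,
-- individual variables x_0, x_1, x_2):
--  ∀A ∃T ( T is a strict linear order of A
--          ∧ ∀B ((∃x Bx ∧ ∀x (Bx → Ax)) → ∃x (Bx ∧ ∀y (By → ¬ Tyx))) )
-- where "T is a strict linear order of A" is:
--   ∀x∀y (Txy → Ax ∧ Ay) ∧ ∀x ¬Txx ∧ ∀x∀y∀z (Txy ∧ Tyz → Txz)
--   ∧ ∀x∀y (Ax ∧ Ay → Txy ∨ x = y ∨ Tyx)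

private
  A' : ℕ → Formula
  A' x = atom 0 0 (x ∷ [])
  B' : ℕ → Formula
  B' x = atom 0 1 (x ∷ [])
  T' : ℕ → ℕ → Formula
  T' x y = atom 1 0 (x ∷ y ∷ [])

LinOrd : Formula
LinOrd =
  ∀i 0 (∀i 1 (T' 0 1 ⇒' (A' 0 ∧' A' 1))) ∧'
  ∀i 0 (¬' (T' 0 0)) ∧'
  ∀i 0 (∀i 1 (∀i 2 ((T' 0 1 ∧' T' 1 2) ⇒' T' 0 2))) ∧'
  ∀i 0 (∀i 1 ((A' 0 ∧' A' 1) ⇒' (T' 0 1 ∨' eqI 0 1 ∨' T' 1 0)))

LeastElts : Formula
LeastElts =
  ∀p 0 1 ((∃i 0 (B' 0) ∧' ∀i 0 (B' 0 ⇒' A' 0)) ⇒'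
          ∃i 0 (B' 0 ∧' ∀i 1 (B' 1 ⇒' ¬' (T' 1 0))))

WO¹ : Formula
WO¹ = ∀p 0 0 (∃p 1 0 (LinOrd ∧' LeastElts))

_∪｛_｝ : (Formula → Set) → Formula → (Formula → Set)
(Γ ∪｛ ψ ｝) φ = Γ φ ⊎ (φ ≡ ψ)

{-# OPTIONS --safe #-}
module Submission where

-- Both structures are built classically: excluded middle turns every formula into a Boolean-valued
-- predicate, so comprehension only asks that the predicates it defines belong to the structure.
--
-- For WO¹ we take the one-point structure containing all predicates: the empty relation
-- well-orders it, and choice is trivial because every family of predicates glues to a predicate.
--
-- For ¬ WO¹ we take the permutation model on ℕ: the n-ary predicates are those invariant under
-- every permutation that fixes some initial segment [0, N) pointwise. Satisfaction is invariant
-- under permutations (applied to the individuals and, by relabelling, to the predicates), so a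
-- formula with parameters defines a predicate supported by a bound on its parameters; this gives
-- comprehension. A binary predicate supported by [0, N) cannot distinguish N from N + 1, so it
-- does not linearly order ℕ. For choice, the parameter-free formula H(x, D) is invariant under all
-- permutations. Choose a witness D_p for each of the finitely many equality patterns p of an
-- n-tuple and let B bound their supports. For a tuple x, the permutation θ x swaps [0, B) with the
-- first of n + 1 disjoint blocks of length B that x misses, and then swaps the positions of that
-- block with the entries of x, so it carries the pattern of x to x. The relabelled witness
-- θ x (D_{pattern x}) works for x. Since θ commutes on [0, B) with every permutation fixing all the
-- blocks, the glued predicate S(x, y) is supported by the end of the last block.

open import Defs
open import Level using (0ℓ)
open import Axiom.ExcludedMiddle using (ExcludedMiddle)
open import Data.Nat using (ℕ; zero; suc; _+_; _*_; _∸_; _⊔_; _≟_; _<_; _≤_; _<?_; _≤?_; z≤n; s≤s)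
open import Data.Nat.Properties
  using (1+n≢n; m+1+n≢n; ≤-refl; ≤-trans; <-≤-trans; ≤-pred; m≤m⊔n; m≤n⊔m;
         m<1+n⇒m<n∨m≡n; m≤n⇒m<n∨m≡n; <⇒≢; <⇒≱; m<n⇒m<1+n; n<1+n; m≤m+n; +-comm;
         +-monoʳ-≤; +-monoˡ-≤; +-monoʳ-<; *-monoˡ-≤; m+n∸m≡n; m+[n∸m]≡n; +-cancelˡ-<)
open import Data.Bool using (Bool; true; false)
open import Data.Unit using (⊤; tt)
open import Data.Empty using (⊥; ⊥-elim)
open import Data.Fin using (Fin; toℕ; _↑ˡ_; _↑ʳ_; splitAt)
open import Data.Fin.Properties
  using (↑ˡ-injective; ↑ʳ-injective; splitAt-↑ˡ; splitAt-↑ʳ; suc-injective; 0≢1+n; pigeonhole; toℕ<n; any?)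
open import Data.Vec using (Vec; []; _∷_; map; lookup; _++_; take; drop)
open import Data.Vec.Properties
  using (map-id; map-++; map-∘; map-cong; lookup-map; lookup-++ˡ; lookup-++ʳ; tabulate∘lookup; tabulate-cong;
         take++drop≡id; ++-injective)
open import Data.Product using (Σ; Σ-syntax; ∃-syntax; _×_; _,_; proj₁; proj₂)
open import Data.Product.Function.NonDependent.Propositional using (_×-⇔_)
open import Data.Sum using (inj₁; inj₂; [_,_]′)
open import Data.Sum.Function.Propositional using (_⊎-⇔_)
open import Function using (_∘_; id; _⇔_; mk⇔; Equivalence; _↔_; Inverse; Injection; mk↔ₛ′)
open import Function.Definitions using (Injective)
open import Function.Properties.Inverse using (↔⇒↣)
open import Function.Construct.Identity using (↔-id)
open import Function.Construct.Composition using (_⇔-∘_; _↔-∘_)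
open import Function.Construct.Symmetry using (↔-sym; ⇔-sym)
open import Function.Related.TypeIsomorphisms using (¬-cong-⇔; →-cong-⇔)
open import Relation.Nullary using (¬_; yes; no; Dec; does)
open import Relation.Nullary.Decidable using (does-⇔; _×-dec_)
open import Relation.Unary using (Decidable)
open import Relation.Binary.PropositionalEquality
  using (_≡_; _≢_; refl; sym; trans; cong; cong₂; subst; module ≡-Reasoning)

private variable
  n : ℕ
  X Y : Set

vec-ext : (u w : Vec X n) → (∀ j → lookup u j ≡ lookup w j) → u ≡ w
vec-ext u w u≗w = trans (sym (tabulate∘lookup u)) (trans (tabulate-cong u≗w) (tabulate∘lookup w))

map-cong-entries : ∀ {f g : X → Y} (xs : Vec X n) → (∀ j → f (lookup xs j) ≡ g (lookup xs j)) →
  map f xs ≡ map g xs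
map-cong-entries []       _  = refl
map-cong-entries (x ∷ xs) eq = cong₂ _∷_ (eq Fin.zero) (map-cong-entries xs (eq ∘ Fin.suc))

↔-injective : (π : X ↔ Y) → Injective _≡_ _≡_ (Inverse.to π)
↔-injective π = Injection.injective (↔⇒↣ π)

∀-cong-⇔ : {P : X → Set} {Q : Y → Set} (f : X → Y) (g : Y → X) →
  (∀ a → P a ⇔ Q (f a)) → (∀ b → P (g b) ⇔ Q b) → ((a : X) → P a) ⇔ ((b : Y) → Q b)
∀-cong-⇔ f g P⇔Qf Pg⇔Q =
  mk⇔ (λ p b → Equivalence.to (Pg⇔Q b) (p (g b))) (λ q a → Equivalence.from (P⇔Qf a) (q (f a)))

∃-cong-⇔ : {P : X → Set} {Q : Y → Set} (f : X → Y) (g : Y → X) →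
  (∀ a → P a ⇔ Q (f a)) → (∀ b → P (g b) ⇔ Q b) → Σ X P ⇔ Σ Y Q
∃-cong-⇔ f g P⇔Qf Pg⇔Q =
  mk⇔ (λ (a , p) → f a , Equivalence.to (P⇔Qf a) p) (λ (b , q) → g b , Equivalence.from (Pg⇔Q b) q)

does≡true-⇔ : (a? : Dec X) → (does a? ≡ true) ⇔ X
does≡true-⇔ (yes a) = mk⇔ (λ _ → a) (λ _ → refl)
does≡true-⇔ (no ¬a) = mk⇔ (λ ()) (λ a → ⊥-elim (¬a a))

distinct-tail : ∀ {x} (xs : Vec ℕ n) → Distinct (x ∷ xs) → Distinct xs
distinct-tail xs dis p q e = suc-injective (dis (Fin.suc p) (Fin.suc q) e)

distinct-head : ∀ {x} (xs : Vec ℕ n) → Distinct (x ∷ xs) → ∀ j → lookup xs j ≢ x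
distinct-head xs dis j e = 0≢1+n (sym (dis (Fin.suc j) Fin.zero e))

module _ {m} (xs : Vec ℕ n) (ys : Vec ℕ m) (dis : Distinct (xs ++ ys)) where

  distinct-++ˡ : Distinct xs
  distinct-++ˡ p q e = ↑ˡ-injective m p q
    (dis (p ↑ˡ m) (q ↑ˡ m) (trans (lookup-++ˡ xs ys p) (trans e (sym (lookup-++ˡ xs ys q)))))

  distinct-++ʳ : Distinct ys
  distinct-++ʳ p q e = ↑ʳ-injective n p q
    (dis (n ↑ʳ p) (n ↑ʳ q) (trans (lookup-++ʳ xs ys p) (trans e (sym (lookup-++ʳ xs ys q)))))

  distinct-++-disjoint : ∀ i j → lookup xs i ≢ lookup ys j
  distinct-++-disjoint i j e =
    ↑ˡ≢↑ʳ (dis (i ↑ˡ m) (n ↑ʳ j) (trans (lookup-++ˡ xs ys i) (trans e (sym (lookup-++ʳ xs ys j)))))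
    where
    ↑ˡ≢↑ʳ : i ↑ˡ m ≢ n ↑ʳ j
    ↑ˡ≢↑ʳ same with () ← trans (sym (splitAt-↑ˡ n i m)) (trans (cong (splitAt n) same) (splitAt-↑ʳ n m j))

module Semantics (M : PredStructure) where
  open PredStructure M
  open Assignment

  updI-same : ∀ (ρ : Assignment M) x d → ind (updI M ρ x d) x ≡ d
  updI-same ρ x d with x ≟ x
  ... | yes _   = refl
  ... | no x≢x = ⊥-elim (x≢x refl)

  updI-other : ∀ (ρ : Assignment M) x d i → i ≢ x → ind (updI M ρ x d) i ≡ ind ρ i
  updI-other ρ x d i i≢x with i ≟ x
  ... | yes i≡x = ⊥-elim (i≢x i≡x)
  ... | no _    = refl

  updI-image : ∀ (f : J₀ → J₀) (ρ ρ' : Assignment M) x d d' i → d' ≡ f d →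
    (i ≢ x → ind ρ' i ≡ f (ind ρ i)) → ind (updI M ρ' x d') i ≡ f (ind (updI M ρ x d) i)
  updI-image f ρ ρ' x d d' i d'≡fd outside with i ≟ x
  ... | yes _   = d'≡fd
  ... | no i≢x = outside i≢x

  updP-same : ∀ (ρ : Assignment M) k a P → prd (updP M ρ k a P) k a ≡ P
  updP-same ρ k a P with k ≟ k | a ≟ a
  ... | yes refl | yes _   = refl
  ... | yes refl | no a≢a = ⊥-elim (a≢a refl)
  ... | no k≢k   | _       = ⊥-elim (k≢k refl)

  updP-other : ∀ (ρ : Assignment M) k a P l i → ¬ (l ≡ k × i ≡ a) → prd (updP M ρ k a P) l i ≡ prd ρ l i
  updP-other ρ k a P l i ≢ka with k ≟ l | a ≟ i
  ... | yes refl | yes refl = ⊥-elim (≢ka (refl , refl))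
  ... | yes refl | no _     = refl
  ... | no _     | _        = refl

  updI* : Assignment M → Vec ℕ n → Vec J₀ n → Assignment M
  updI* ρ []       []       = ρ
  updI* ρ (x ∷ xs) (d ∷ ds) = updI* (updI M ρ x d) xs ds

  prd-updI* : ∀ (ρ : Assignment M) (xs : Vec ℕ n) v → prd (updI* ρ xs v) ≡ prd ρ
  prd-updI* ρ []       []       = refl
  prd-updI* ρ (x ∷ xs) (d ∷ ds) = prd-updI* (updI M ρ x d) xs ds

  ind-updI*-fresh : ∀ (ρ : Assignment M) (xs : Vec ℕ n) v i → (∀ j → lookup xs j ≢ i) →
    ind (updI* ρ xs v) i ≡ ind ρ i
  ind-updI*-fresh ρ []       []       i _     = refl
  ind-updI*-fresh ρ (x ∷ xs) (d ∷ ds) i fresh =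
    trans (ind-updI*-fresh (updI M ρ x d) xs ds i (fresh ∘ Fin.suc)) (updI-other ρ x d i (fresh Fin.zero ∘ sym))

  ind-updI*-lookup : ∀ (ρ : Assignment M) (xs : Vec ℕ n) v → Distinct xs → ∀ j →
    ind (updI* ρ xs v) (lookup xs j) ≡ lookup v j
  ind-updI*-lookup ρ (x ∷ xs) (d ∷ ds) dis Fin.zero =
    trans (ind-updI*-fresh (updI M ρ x d) xs ds x (distinct-head xs dis)) (updI-same ρ x d)
  ind-updI*-lookup ρ (x ∷ xs) (d ∷ ds) dis (Fin.suc j) =
    ind-updI*-lookup (updI M ρ x d) xs ds (distinct-tail xs dis) j

  map-ind-updI* : ∀ (ρ : Assignment M) (xs : Vec ℕ n) v → Distinct xs → map (ind (updI* ρ xs v)) xs ≡ v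
  map-ind-updI* ρ xs v dis = vec-ext _ v λ j → trans (lookup-map j _ xs) (ind-updI*-lookup ρ xs v dis j)

  ind-updI*-image : ∀ (f : J₀ → J₀) (ρ ρ' : Assignment M) (xs : Vec ℕ n) v v' i →
    (∀ j → lookup v' j ≡ f (lookup v j)) → ((∀ j → lookup xs j ≢ i) → ind ρ' i ≡ f (ind ρ i)) →
    ind (updI* ρ' xs v') i ≡ f (ind (updI* ρ xs v) i)
  ind-updI*-image f ρ ρ' []       []       []         i _     outside = outside (λ ())
  ind-updI*-image f ρ ρ' (x ∷ xs) (d ∷ ds) (d' ∷ ds') i v'≗fv outside =
    ind-updI*-image f (updI M ρ x d) (updI M ρ' x d') xs ds ds' i (v'≗fv ∘ Fin.suc) λ fresh →
      updI-image f ρ ρ' x d d' i (v'≗fv Fin.zero) λ i≢x → outside λ where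
        Fin.zero    → i≢x ∘ sym
        (Fin.suc j) → fresh j

  atom-updI*-updP : ∀ (ρ : Assignment M) k a P (xs : Vec ℕ (suc k)) v → Distinct xs →
    let ρ' = updI* (updP M ρ k a P) xs v in proj₁ (prd ρ' k a) (map (ind ρ') xs) ≡ proj₁ P v
  atom-updI*-updP ρ k a P xs v dis = begin
    proj₁ (prd (updI* ρ₁ xs v) k a) u ≡⟨ cong (λ r → proj₁ (r k a) u) (prd-updI* ρ₁ xs v) ⟩
    proj₁ (prd ρ₁ k a) u              ≡⟨ cong (λ Q → proj₁ Q u) (updP-same ρ k a P) ⟩
    proj₁ P u                         ≡⟨ cong (proj₁ P) (map-ind-updI* ρ₁ xs v dis) ⟩
    proj₁ P v                         ∎
    where
    open ≡-Reasoning
    ρ₁ = updP M ρ k a P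
    u  = map (ind (updI* ρ₁ xs v)) xs

  Sat-∀i* : ∀ (xs : Vec ℕ n) φ ρ → Sat M (∀i* xs φ) ρ ⇔ (∀ v → Sat M φ (updI* ρ xs v))
  Sat-∀i* []       φ ρ = mk⇔ (λ { s [] → s }) (λ s → s [])
  Sat-∀i* (x ∷ xs) φ ρ = mk⇔
    (λ { s (d ∷ ds) → Equivalence.to (Sat-∀i* xs φ (updI M ρ x d)) (s d) ds })
    (λ s d → Equivalence.from (Sat-∀i* xs φ (updI M ρ x d)) (s ∘ (d ∷_)))

  ImageUnder : ∀ {k} → (J₀ → J₀) → Pred J₀ k → Pred J₀ k → Set
  ImageUnder f P Q = ∀ v → Q (map f v) ≡ P v

  -- Predicates are transported only up to extensional equality, so J need not be closed under
  -- composition with the bijection; this is what makes the identity an automorphism of every M.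
  record Automorphism : Set where
    field
      bijection : J₀ ↔ J₀
      image     : ∀ {k} (P : JElt M k) → Σ[ Q ∈ JElt M k ] ImageUnder (Inverse.to bijection) (proj₁ P) (proj₁ Q)
      preimage  : ∀ {k} (Q : JElt M k) → Σ[ P ∈ JElt M k ] ImageUnder (Inverse.to bijection) (proj₁ P) (proj₁ Q)
    open Inverse bijection public using (to; from)

  id-automorphism : Automorphism
  id-automorphism = record
    { bijection = ↔-id J₀
    ; image     = λ P → P , λ v → cong (proj₁ P) (map-id v)
    ; preimage  = λ Q → Q , λ v → cong (proj₁ Q) (map-id v)
    }

  module _ (α : Automorphism) where
    open Automorphism α
    open Inverse bijection using (strictlyInverseˡ)

    Agree : Formula → Assignment M → Assignment M → Set
    Agree φ ρ ρ' = (∀ i → FreeI i φ → ind ρ' i ≡ to (ind ρ i))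
                 × (∀ k i → FreeP k i φ → ImageUnder to (proj₁ (prd ρ k i)) (proj₁ (prd ρ' k i)))

    private
      map-to-from : ∀ {k} (v : Vec J₀ k) → map to (map from v) ≡ v
      map-to-from v = trans (sym (map-∘ to from v)) (trans (map-cong strictlyInverseˡ v) (map-id v))

      Agree-ˡ : ∀ φ ψ ρ ρ' → Agree (φ ∧' ψ) ρ ρ' → Agree φ ρ ρ'
      Agree-ˡ φ ψ ρ ρ' (ai , ap) = (λ i → ai i ∘ inj₁) , (λ k i → ap k i ∘ inj₁)

      Agree-ʳ : ∀ φ ψ ρ ρ' → Agree (φ ∧' ψ) ρ ρ' → Agree ψ ρ ρ'
      Agree-ʳ φ ψ ρ ρ' (ai , ap) = (λ i → ai i ∘ inj₂) , (λ k i → ap k i ∘ inj₂)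

      Agree-updI : ∀ x φ ρ ρ' → Agree (∀i x φ) ρ ρ' → ∀ d d' → d' ≡ to d →
        Agree φ (updI M ρ x d) (updI M ρ' x d')
      Agree-updI x φ ρ ρ' (ai , ap) d d' d'≡td =
        (λ i free → updI-image to ρ ρ' x d d' i d'≡td (λ i≢x → ai i (i≢x , free))) , ap

      Agree-updP : ∀ k a φ ρ ρ' → Agree (∀p k a φ) ρ ρ' → ∀ P Q → ImageUnder to (proj₁ P) (proj₁ Q) →
        Agree φ (updP M ρ k a P) (updP M ρ' k a Q)
      Agree-updP k a φ ρ ρ' (ai , ap) P Q P↦Q = ai , ap'
        where
        ap' : ∀ l i → FreeP l i φ →
          ImageUnder to (proj₁ (prd (updP M ρ k a P) l i)) (proj₁ (prd (updP M ρ' k a Q) l i))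
        ap' l i free with k ≟ l | a ≟ i
        ... | yes refl | yes refl = P↦Q
        ... | yes refl | no a≢i   = ap l i ((λ (_ , i≡a) → a≢i (sym i≡a)) , free)
        ... | no k≢l   | _        = ap l i ((λ (l≡k , _) → k≢l (sym l≡k)) , free)

    Sat-transport : ∀ φ ρ ρ' → Agree φ ρ ρ' → Sat M φ ρ ⇔ Sat M φ ρ'
    Sat-transport (eqI a b) ρ ρ' (ai , _) = mk⇔
      (λ e → trans (ai a (inj₁ refl)) (trans (cong to e) (sym (ai b (inj₂ refl)))))
      (λ e → ↔-injective bijection (trans (sym (ai a (inj₁ refl))) (trans e (ai b (inj₂ refl)))))
    Sat-transport (eqP k a b) ρ ρ' (_ , ap) = mk⇔
      (λ e v → begin
        proj₁ (prd ρ' k a) v                     ≡⟨ cong (proj₁ (prd ρ' k a)) (map-to-from v) ⟨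
        proj₁ (prd ρ' k a) (map to (map from v)) ≡⟨ ap k a (inj₁ (refl , refl)) (map from v) ⟩
        proj₁ (prd ρ k a) (map from v)           ≡⟨ e (map from v) ⟩
        proj₁ (prd ρ k b) (map from v)           ≡⟨ ap k b (inj₂ (refl , refl)) (map from v) ⟨
        proj₁ (prd ρ' k b) (map to (map from v)) ≡⟨ cong (proj₁ (prd ρ' k b)) (map-to-from v) ⟩
        proj₁ (prd ρ' k b) v                     ∎)
      (λ e v → trans (sym (ap k a (inj₁ (refl , refl)) v)) (trans (e (map to v)) (ap k b (inj₂ (refl , refl)) v)))
      where open ≡-Reasoning
    Sat-transport (atom k a xs) ρ ρ' (ai , ap) = mk⇔ (trans same) (trans (sym same))
      where
      same : proj₁ (prd ρ' k a) (map (ind ρ') xs) ≡ proj₁ (prd ρ k a) (map (ind ρ) xs)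
      same = trans (cong (proj₁ (prd ρ' k a))
                         (trans (map-cong-entries xs (λ j → ai _ (j , refl))) (map-∘ to (ind ρ) xs)))
                   (ap k a (refl , refl) (map (ind ρ) xs))
    Sat-transport (¬' φ) ρ ρ' ag = ¬-cong-⇔ (Sat-transport φ ρ ρ' ag)
    Sat-transport (φ ∧' ψ) ρ ρ' ag =
      Sat-transport φ ρ ρ' (Agree-ˡ φ ψ ρ ρ' ag) ×-⇔ Sat-transport ψ ρ ρ' (Agree-ʳ φ ψ ρ ρ' ag)
    Sat-transport (φ ∨' ψ) ρ ρ' ag =
      Sat-transport φ ρ ρ' (Agree-ˡ φ ψ ρ ρ' ag) ⊎-⇔ Sat-transport ψ ρ ρ' (Agree-ʳ φ ψ ρ ρ' ag)
    Sat-transport (φ ⇒' ψ) ρ ρ' ag =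
      →-cong-⇔ (Sat-transport φ ρ ρ' (Agree-ˡ φ ψ ρ ρ' ag)) (Sat-transport ψ ρ ρ' (Agree-ʳ φ ψ ρ ρ' ag))
    Sat-transport (φ ⇔' ψ) ρ ρ' ag = →-cong-⇔ φ⇔ ψ⇔ ×-⇔ →-cong-⇔ ψ⇔ φ⇔
      where
      φ⇔ = Sat-transport φ ρ ρ' (Agree-ˡ φ ψ ρ ρ' ag)
      ψ⇔ = Sat-transport ψ ρ ρ' (Agree-ʳ φ ψ ρ ρ' ag)
    Sat-transport (∀i x φ) ρ ρ' ag = ∀-cong-⇔ to from
      (λ d → Sat-transport φ _ _ (Agree-updI x φ ρ ρ' ag d (to d) refl))
      (λ d → Sat-transport φ _ _ (Agree-updI x φ ρ ρ' ag (from d) d (sym (strictlyInverseˡ d))))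
    Sat-transport (∃i x φ) ρ ρ' ag = ∃-cong-⇔ to from
      (λ d → Sat-transport φ _ _ (Agree-updI x φ ρ ρ' ag d (to d) refl))
      (λ d → Sat-transport φ _ _ (Agree-updI x φ ρ ρ' ag (from d) d (sym (strictlyInverseˡ d))))
    Sat-transport (∀p k a φ) ρ ρ' ag = ∀-cong-⇔ (proj₁ ∘ image) (proj₁ ∘ preimage)
      (λ P → Sat-transport φ _ _ (Agree-updP k a φ ρ ρ' ag P _ (proj₂ (image P))))
      (λ Q → Sat-transport φ _ _ (Agree-updP k a φ ρ ρ' ag _ Q (proj₂ (preimage Q))))
    Sat-transport (∃p k a φ) ρ ρ' ag = ∃-cong-⇔ (proj₁ ∘ image) (proj₁ ∘ preimage)
      (λ P → Sat-transport φ _ _ (Agree-updP k a φ ρ ρ' ag P _ (proj₂ (image P))))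
      (λ Q → Sat-transport φ _ _ (Agree-updP k a φ ρ ρ' ag _ Q (proj₂ (preimage Q))))

  Sat-coincidence : ∀ φ ρ ρ' → (∀ i → FreeI i φ → ind ρ' i ≡ ind ρ i) →
    (∀ k i → FreeP k i φ → prd ρ' k i ≡ prd ρ k i) → Sat M φ ρ ⇔ Sat M φ ρ'
  Sat-coincidence φ ρ ρ' ai ap = Sat-transport id-automorphism φ ρ ρ' (ai , ap')
    where
    ap' : ∀ k i → FreeP k i φ → ImageUnder id (proj₁ (prd ρ k i)) (proj₁ (prd ρ' k i))
    ap' k i free v = trans (cong (λ P → proj₁ P (map id v)) (ap k i free)) (cong (proj₁ (prd ρ k i)) (map-id v))

  characteristic : ExcludedMiddle 0ℓ → Assignment M → Vec ℕ n → Formula → Vec J₀ n → Bool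
  characteristic em ρ xs H v = does (em {Sat M H (updI* ρ xs v)})

  definable⇒Henkin : (em : ExcludedMiddle 0ℓ) →
    (∀ ρ k (xs : Vec ℕ (suc k)) H → J k (characteristic em ρ xs H)) → IsHenkin M
  definable⇒Henkin em definable _ (k , a , xs , H , dis , a∉H , refl) ρ =
    P , Equivalence.from (Sat-∀i* xs _ ρ₁) λ v → Equivalence.to (atom⇔H v) , Equivalence.from (atom⇔H v)
    where
    P  = characteristic em ρ xs H , definable ρ k xs H
    ρ₁ = updP M ρ k a P

    a-irrelevant : ∀ v → Sat M H (updI* ρ xs v) ⇔ Sat M H (updI* ρ₁ xs v)
    a-irrelevant v = Sat-coincidence H _ _
      (λ i _ → ind-updI*-image id ρ ρ₁ xs v v i (λ _ → refl) (λ _ → refl))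
      (λ l i free → begin
        prd (updI* ρ₁ xs v) l i ≡⟨ cong (λ r → r l i) (prd-updI* ρ₁ xs v) ⟩
        prd ρ₁ l i              ≡⟨ updP-other ρ k a P l i (λ { (refl , refl) → a∉H (inj₁ free) }) ⟩
        prd ρ l i               ≡⟨ cong (λ r → r l i) (prd-updI* ρ xs v) ⟨
        prd (updI* ρ xs v) l i  ∎)
      where open ≡-Reasoning

    atom⇔H : ∀ v → Sat M (atom k a xs) (updI* ρ₁ xs v) ⇔ Sat M H (updI* ρ₁ xs v)
    atom⇔H v = a-irrelevant v ⇔-∘ (does≡true-⇔ (em {Sat M H (updI* ρ xs v)}) ⇔-∘ atom-is-P)
      where
      atom-value = atom-updI*-updP ρ k a P xs v dis
      atom-is-P  = mk⇔ (trans (sym atom-value)) (trans atom-value)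

  glue : ∀ {a b} → (Vec J₀ (suc a) → JElt M b) → Pred J₀ (a + suc b)
  glue {a} F v = proj₁ (F (take (suc a) v)) (drop (suc a) v)

  glue-++ : ∀ {a b} (F : Vec J₀ (suc a) → JElt M b) x y → glue F (x ++ y) ≡ proj₁ (F x) y
  glue-++ {a} F x y = cong₂ (λ x' y' → proj₁ (F x') y') (proj₁ split) (proj₂ split)
    where split = ++-injective (take (suc a) (x ++ y)) x (take++drop≡id (suc a) (x ++ y))

  Invariant : ∀ {a b} → (Vec J₀ (suc a) → JElt M b → Set) → Set
  Invariant W = ∀ (α : Automorphism) {x x' D D'} → (∀ j → lookup x' j ≡ Automorphism.to α (lookup x j)) →
    ImageUnder (Automorphism.to α) (proj₁ D) (proj₁ D') → W x D → W x' D'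

  -- The semantic content of choice^{a+1,b+1}_h: here W is the relation defined by H.
  Uniformization : ℕ → ℕ → Set₁
  Uniformization a b = (W : Vec J₀ (suc a) → JElt M b → Set) → Invariant W → (∀ x → Σ (JElt M b) (W x)) →
    Σ[ F ∈ (Vec J₀ (suc a) → JElt M b) ] (∀ x → W x (F x)) × J (a + suc b) (glue F)

  module ChoiceInstance {a b} (xs : Vec ℕ (suc a)) (ys : Vec ℕ (suc b)) (d s : ℕ) (H : Formula)
    (dis : Distinct (xs ++ ys))
    (freeI : ∀ i → FreeI i H → Σ[ j ∈ Fin (suc a) ] lookup xs j ≡ i)
    (freeP : ∀ k i → FreeP k i H → k ≡ b × i ≡ d) where

    Witness : Assignment M → Vec J₀ (suc a) → JElt M b → Set
    Witness ρ x D = Sat M H (updP M (updI* ρ xs x) b d D)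

    Witness-transport : ∀ (α : Automorphism) ρ ρ' {x x' D D'} →
      (∀ j → lookup x' j ≡ Automorphism.to α (lookup x j)) →
      ImageUnder (Automorphism.to α) (proj₁ D) (proj₁ D') → Witness ρ x D → Witness ρ' x' D'
    Witness-transport α ρ ρ' {x} {x'} {D} {D'} x↦x' D↦D' = Equivalence.to (Sat-transport α H _ _ (ai , ap))
      where
      open Automorphism α using (to)
      xs-distinct = distinct-++ˡ xs ys dis

      ai : ∀ i → FreeI i H → ind (updI* ρ' xs x') i ≡ to (ind (updI* ρ xs x) i)
      ai i free with freeI i free
      ... | j , refl = trans (ind-updI*-lookup ρ' xs x' xs-distinct j)
                      (trans (x↦x' j) (cong to (sym (ind-updI*-lookup ρ xs x xs-distinct j))))

      ap : ∀ l i → FreeP l i H → ImageUnder to (proj₁ (prd (updP M (updI* ρ xs x) b d D) l i))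
                                               (proj₁ (prd (updP M (updI* ρ' xs x') b d D') l i))
      ap l i free with freeP l i free
      ... | refl , refl rewrite updP-same (updI* ρ xs x) b d D | updP-same (updI* ρ' xs x') b d D' = D↦D'

    holds : Uniformization a b → Holds M (choiceFormula a b xs ys d s H)
    holds uniformize ρ total =
      S , Equivalence.from (Sat-∀i* xs _ ρS) λ x →
        F x , Equivalence.from (Sat-∀i* ys _ _) (D⇔S x) ,
        Witness-transport id-automorphism ρ ρS (λ _ → refl) (λ v → cong (proj₁ (F x)) (map-id v)) (F-witness x)
      where
      uniform   = uniformize (Witness ρ) (λ α → Witness-transport α ρ ρ) (Equivalence.to (Sat-∀i* xs _ ρ) total)
      F         = proj₁ uniform
      F-witness = proj₁ (proj₂ uniform)
      S         = glue F , proj₂ (proj₂ uniform)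
      ρS        = updP M ρ (a + suc b) s S

      module _ (x : Vec J₀ (suc a)) (y : Vec J₀ (suc b)) where
        ρ₂ = updP M (updI* ρS xs x) b d (F x)
        ρ₃ = updI* ρ₂ ys y

        xs-value : ∀ j → ind ρ₃ (lookup xs j) ≡ lookup x j
        xs-value j =
          trans (ind-updI*-fresh ρ₂ ys y _ xⱼ∉ys) (ind-updI*-lookup ρS xs x (distinct-++ˡ xs ys dis) j)
          where xⱼ∉ys = λ k → distinct-++-disjoint xs ys dis j k ∘ sym

        xs-values : map (ind ρ₃) xs ≡ x
        xs-values = vec-ext _ x λ j → trans (lookup-map j (ind ρ₃) xs) (xs-value j)

        S-value : proj₁ (prd ρ₃ (a + suc b) s) (map (ind ρ₃) (xs ++ ys)) ≡ proj₁ (F x) y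
        S-value = begin
          proj₁ (prd ρ₃ (a + suc b) s) args
            ≡⟨ cong (λ r → proj₁ (r (a + suc b) s) args) (prd-updI* ρ₂ ys y) ⟩
          proj₁ (prd ρ₂ (a + suc b) s) args
            ≡⟨ cong (λ Q → proj₁ Q args) (updP-other (updI* ρS xs x) b d (F x) (a + suc b) s S≢D) ⟩
          proj₁ (prd (updI* ρS xs x) (a + suc b) s) args
            ≡⟨ cong (λ r → proj₁ (r (a + suc b) s) args) (prd-updI* ρS xs x) ⟩
          proj₁ (prd ρS (a + suc b) s) args
            ≡⟨ cong (λ Q → proj₁ Q args) (updP-same ρ (a + suc b) s S) ⟩
          glue F args
            ≡⟨ cong (glue F) (trans (map-++ (ind ρ₃) xs ys) (cong₂ _++_ xs-values ys-values)) ⟩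
          glue F (x ++ y)
            ≡⟨ glue-++ F x y ⟩
          proj₁ (F x) y ∎
          where
          open ≡-Reasoning
          args      = map (ind ρ₃) (xs ++ ys)
          S≢D       = m+1+n≢n a ∘ proj₁
          ys-values = map-ind-updI* ρ₂ ys y (distinct-++ʳ xs ys dis)

        D⇔S : Sat M (atom b d ys ⇔' atom (a + suc b) s (xs ++ ys)) ρ₃
        D⇔S = trans (trans S-value (sym D-value)) , trans (trans D-value (sym S-value))
          where D-value = atom-updI*-updP (updI* ρS xs x) b d (F x) ys y (distinct-++ʳ xs ys dis)

  uniformization⇒choiceH : (∀ a b → Uniformization a b) → ∀ n m → ModelOf M (ChoiceH n m)
  uniformization⇒choiceH uniformize (suc a) (suc b) _ (xs , ys , d , s , H , dis , freeI , freeP , _ , _ , refl) =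
    ChoiceInstance.holds xs ys d s H dis freeI freeP (uniformize a b)

  models-∪ : ∀ {Γ φ} → ModelOf M Γ → Holds M φ → ModelOf M (Γ ∪｛ φ ｝)
  models-∪ ⊨Γ ⊨φ ψ (inj₁ ψ∈Γ) = ⊨Γ ψ ψ∈Γ
  models-∪ ⊨Γ ⊨φ _ (inj₂ refl) = ⊨φ

open Semantics

module OnePoint where

  M₁ : PredStructure
  M₁ = record { J₀ = ⊤ ; j₀ = tt ; J = λ _ _ → ⊤ ; Jne = λ _ → (λ _ → true) , tt }

  M₁-henkin : ExcludedMiddle 0ℓ → IsHenkin M₁
  M₁-henkin em = definable⇒Henkin M₁ em (λ _ _ _ _ → tt)

  M₁-uniformization : ∀ a b → Uniformization M₁ a b
  M₁-uniformization a b W _ total = proj₁ ∘ total , proj₂ ∘ total , tt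

  M₁-WO¹ : Holds M₁ WO¹
  M₁-WO¹ ρ A = ((λ _ → false) , tt) ,
    ((λ _ _ ()) , (λ _ ()) , (λ { _ _ _ (() , _) }) , (λ _ _ _ → inj₂ (inj₁ refl))) ,
    (λ { B ((d , Bd) , _) → d , Bd , (λ _ _ ()) })

open Inverse using (to; from; strictlyInverseˡ; strictlyInverseʳ)

involution : (f : ℕ → ℕ) → (∀ z → f (f z) ≡ z) → ℕ ↔ ℕ
involution f f∘f≗id = mk↔ₛ′ f f f∘f≗id f∘f≗id

Fixes : ℕ ↔ ℕ → ℕ → Set
Fixes π N = ∀ z → z < N → to π z ≡ z

transpose : ℕ → ℕ → ℕ → ℕ
transpose p q z with z ≟ p | z ≟ q
... | yes _ | _     = q
... | no _  | yes _ = p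
... | no _  | no _  = z

transpose-p : ∀ p q → transpose p q p ≡ q
transpose-p p q with p ≟ p
... | yes _   = refl
... | no p≢p = ⊥-elim (p≢p refl)

transpose-q : ∀ p q → transpose p q q ≡ p
transpose-q p q with q ≟ p | q ≟ q
... | yes q≡p | _       = q≡p
... | no _    | yes _   = refl
... | no _    | no q≢q = ⊥-elim (q≢q refl)

transpose-other : ∀ p q z → z ≢ p → z ≢ q → transpose p q z ≡ z
transpose-other p q z z≢p z≢q with z ≟ p | z ≟ q
... | yes z≡p | _       = ⊥-elim (z≢p z≡p)
... | no _    | yes z≡q = ⊥-elim (z≢q z≡q)
... | no _    | no _    = refl

transpose-involutive : ∀ p q z → transpose p q (transpose p q z) ≡ z
transpose-involutive p q z with z ≟ p | z ≟ q
... | yes refl | _        = transpose-q z q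
... | no _     | yes refl = transpose-p p z
... | no z≢p   | no z≢q   = transpose-other p q z z≢p z≢q

bounded-below : (h : ℕ → ℕ) → ∀ n → ∃[ B ] (∀ i → i < n → h i ≤ B)
bounded-below h zero    = 0 , λ _ ()
bounded-below h (suc n) = h n ⊔ B , bound
  where
  B = proj₁ (bounded-below h n)
  bound : ∀ i → i < suc n → h i ≤ h n ⊔ B
  bound i i<1+n with m<1+n⇒m<n∨m≡n i<1+n
  ... | inj₁ i<n  = ≤-trans (proj₂ (bounded-below h n) i i<n) (m≤n⊔m (h n) B)
  ... | inj₂ refl = m≤m⊔n (h n) B

bounded-on-box : ∀ n k (h : Vec ℕ k → ℕ) → ∃[ B ] (∀ p → (∀ j → lookup p j < n) → h p ≤ B)
bounded-on-box n zero    h = h [] , λ { [] _ → ≤-refl }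
bounded-on-box n (suc k) h = proj₁ rows , bound
  where
  row : ∀ i → ∃[ B ] (∀ p → (∀ j → lookup p j < n) → h (i ∷ p) ≤ B)
  row i = bounded-on-box n k (h ∘ (i ∷_))
  rows = bounded-below (proj₁ ∘ row) n
  bound : ∀ p → (∀ j → lookup p j < n) → h p ≤ proj₁ rows
  bound (i ∷ p) p<n = ≤-trans (proj₂ (row i) p (p<n ∘ Fin.suc)) (proj₂ rows i (p<n Fin.zero))

entries-bounded : (v : Vec ℕ n) → ∃[ N ] (∀ j → lookup v j < N)
entries-bounded []      = 0 , λ ()
entries-bounded (x ∷ v) = suc x ⊔ N , λ where
    Fin.zero    → m≤m⊔n (suc x) N
    (Fin.suc j) → <-≤-trans (proj₂ (entries-bounded v) j) (m≤n⊔m (suc x) N)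
  where N = proj₁ (entries-bounded v)

-- This search and the swaps below are opaque: unfolding them on open terms makes type checking explode.
opaque
  firstFailure : {P : ℕ → Set} → Decidable P → ℕ → ℕ
  firstFailure P? zero    = zero
  firstFailure P? (suc k) with P? zero
  ... | yes _ = suc (firstFailure (P? ∘ suc) k)
  ... | no _  = zero

  firstFailure-≤ : ∀ {P : ℕ → Set} (P? : Decidable P) k → firstFailure P? k ≤ k
  firstFailure-≤ P? zero    = z≤n
  firstFailure-≤ P? (suc k) with P? zero
  ... | yes _ = s≤s (firstFailure-≤ (P? ∘ suc) k)
  ... | no _  = z≤n

  firstFailure-below : ∀ {P : ℕ → Set} (P? : Decidable P) k c → c < firstFailure P? k → P c
  firstFailure-below P? (suc k) c c<f with P? zero
  firstFailure-below P? (suc k) zero    _         | yes P0 = P0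
  firstFailure-below P? (suc k) (suc c) (s≤s c<f) | yes _  = firstFailure-below (P? ∘ suc) k c c<f

  firstFailure-fails : ∀ {P : ℕ → Set} (P? : Decidable P) k → firstFailure P? k < k → ¬ P (firstFailure P? k)
  firstFailure-fails P? (suc k) f<k with P? zero
  ... | yes _   = firstFailure-fails (P? ∘ suc) k (≤-pred f<k)
  ... | no ¬P0 = ¬P0

  firstFailure-cong : ∀ {P Q : ℕ → Set} (P? : Decidable P) (Q? : Decidable Q) k →
    (∀ c → c < k → P c ⇔ Q c) → firstFailure P? k ≡ firstFailure Q? k
  firstFailure-cong P? Q? zero    P⇔Q = refl
  firstFailure-cong P? Q? (suc k) P⇔Q with P? zero | Q? zero
  ... | yes _  | yes _  = cong suc (firstFailure-cong (P? ∘ suc) (Q? ∘ suc) k (λ c c<k → P⇔Q (suc c) (s≤s c<k)))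
  ... | yes P0 | no ¬Q0 = ⊥-elim (¬Q0 (Equivalence.to (P⇔Q zero (s≤s z≤n)) P0))
  ... | no ¬P0 | yes Q0 = ⊥-elim (¬P0 (Equivalence.from (P⇔Q zero (s≤s z≤n)) Q0))
  ... | no _   | no _   = refl

-- Junk values: firstIndex x z = n when z does not occur in x, and nth x k = 0 when k ≥ n.
firstIndex : Vec ℕ n → ℕ → ℕ
firstIndex []       z = 0
firstIndex (y ∷ ys) z with z ≟ y
... | yes _ = 0
... | no _  = suc (firstIndex ys z)

nth : Vec ℕ n → ℕ → ℕ
nth []       _       = 0
nth (y ∷ ys) zero    = y
nth (y ∷ ys) (suc k) = nth ys k

firstIndex-lookup : ∀ (x : Vec ℕ n) j → firstIndex x (lookup x j) < n
firstIndex-lookup (y ∷ ys) j with lookup (y ∷ ys) j ≟ y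
... | yes _ = s≤s z≤n
firstIndex-lookup (y ∷ ys) Fin.zero    | no y≢y = ⊥-elim (y≢y refl)
firstIndex-lookup (y ∷ ys) (Fin.suc j) | no _   = s≤s (firstIndex-lookup ys j)

nth-firstIndex : ∀ (x : Vec ℕ n) z → firstIndex x z < n → nth x (firstIndex x z) ≡ z
nth-firstIndex (y ∷ ys) z found with z ≟ y
... | yes z≡y = sym z≡y
... | no _    = nth-firstIndex ys z (≤-pred found)

nth-lookup : ∀ (x : Vec ℕ n) k → k < n → ∃[ j ] lookup x j ≡ nth x k
nth-lookup (y ∷ ys) zero    _   = Fin.zero , refl
nth-lookup (y ∷ ys) (suc k) k<n = let (j , eq) = nth-lookup ys k (≤-pred k<n) in Fin.suc j , eq

nth-map : ∀ (σ : ℕ → ℕ) (x : Vec ℕ n) k → k < n → nth (map σ x) k ≡ σ (nth x k)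
nth-map σ (y ∷ ys) zero    _   = refl
nth-map σ (y ∷ ys) (suc k) k<n = nth-map σ ys k (≤-pred k<n)

firstIndex-map : ∀ {σ : ℕ → ℕ} → Injective _≡_ _≡_ σ → ∀ (x : Vec ℕ n) z →
  firstIndex (map σ x) (σ z) ≡ firstIndex x z
firstIndex-map         σ-injective []       z = refl
firstIndex-map {σ = σ} σ-injective (y ∷ ys) z with σ z ≟ σ y | z ≟ y
... | yes _     | yes _   = refl
... | yes σz≡σy | no z≢y  = ⊥-elim (z≢y (σ-injective σz≡σy))
... | no σz≢σy  | yes z≡y = ⊥-elim (σz≢σy (cong σ z≡y))
... | no _      | no _    = cong suc (firstIndex-map σ-injective ys z)

firstIndex-nth-map : ∀ {σ : ℕ → ℕ} → Injective _≡_ _≡_ σ → ∀ (x : Vec ℕ n) k → k < n →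
  firstIndex (map σ x) (nth (map σ x) k) ≡ firstIndex x (nth x k)
firstIndex-nth-map {σ = σ} σ-injective x k k<n =
  trans (cong (firstIndex (map σ x)) (nth-map σ x k k<n)) (firstIndex-map σ-injective x _)

Slot : Vec ℕ n → ℕ → Set
Slot {n} x k = k < n × firstIndex x (nth x k) ≡ k

slot? : (x : Vec ℕ n) → ∀ k → Dec (Slot x k)
slot? {n} x k = (k <? n) ×-dec (firstIndex x (nth x k) ≟ k)

firstIndex-Slot : ∀ (x : Vec ℕ n) j → Slot x (firstIndex x (lookup x j))
firstIndex-Slot x j = firstIndex-lookup x j , cong (firstIndex x) (nth-firstIndex x _ (firstIndex-lookup x j))

equalityPattern : Vec ℕ n → Vec ℕ n
equalityPattern x = map (firstIndex x) x

equalityPattern-< : ∀ (x : Vec ℕ n) j → lookup (equalityPattern x) j < n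
equalityPattern-< {n} x j = subst (_< n) (sym (lookup-map j (firstIndex x) x)) (firstIndex-lookup x j)

equalityPattern-map : ∀ {σ : ℕ → ℕ} → Injective _≡_ _≡_ σ → ∀ (x : Vec ℕ n) →
  equalityPattern (map σ x) ≡ equalityPattern x
equalityPattern-map {σ = σ} σ-injective x =
  trans (sym (map-∘ (firstIndex (map σ x)) σ x)) (map-cong (firstIndex-map σ-injective x) x)

module Blocks (B : ℕ) where

  base : ℕ → ℕ
  base c = suc c * B

  InBlock : ℕ → ℕ → Set
  InBlock c z = base c ≤ z × z < base c + B

  inBlock? : ∀ c z → Dec (InBlock c z)
  inBlock? c z = (base c ≤? z) ×-dec (z <? base c + B)

  InBlock-base+ : ∀ c {k} → k < B → InBlock c (base c + k)
  InBlock-base+ c k<B = m≤m+n (base c) _ , +-monoʳ-< (base c) k<B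

  InBlock-offset : ∀ c {z} → InBlock c z → z ∸ base c < B
  InBlock-offset c (base≤z , z<) = +-cancelˡ-< (base c) _ _ (subst (_< base c + B) (sym (m+[n∸m]≡n base≤z)) z<)

  <B⇒¬InBlock : ∀ c {z} → z < B → ¬ InBlock c z
  <B⇒¬InBlock c z<B (base≤z , _) = <⇒≱ z<B (≤-trans (m≤m+n B (c * B)) base≤z)

  InBlock-disjoint : ∀ {c c' z} → c < c' → InBlock c z → ¬ InBlock c' z
  InBlock-disjoint {c} {c'} c<c' (_ , z<) (base'≤z , _) = <⇒≱ (<-≤-trans z< end≤base') base'≤z
    where
    end≤base' : base c + B ≤ base c'
    end≤base' = subst (_≤ base c') (+-comm B (base c)) (+-monoʳ-≤ B (*-monoˡ-≤ B c<c'))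

  InBlock-< : ∀ {c n z} → c ≤ n → InBlock c z → z < base n + B
  InBlock-< c≤n (_ , z<) = <-≤-trans z< (+-monoˡ-≤ B (+-monoʳ-≤ B (*-monoˡ-≤ B c≤n)))

  opaque
    swapBlock : ℕ → ℕ → ℕ
    swapBlock c z with z <? B | inBlock? c z
    ... | yes _ | _     = base c + z
    ... | no _  | yes _ = z ∸ base c
    ... | no _  | no _  = z

    swapBlock-< : ∀ c {z} → z < B → swapBlock c z ≡ base c + z
    swapBlock-< c {z} z<B with z <? B
    ... | yes _   = refl
    ... | no z≮B = ⊥-elim (z≮B z<B)

    swapBlock-InBlock : ∀ c {z} → InBlock c z → swapBlock c z ≡ z ∸ base c
    swapBlock-InBlock c {z} in-c with z <? B | inBlock? c z
    ... | yes z<B | _        = ⊥-elim (<B⇒¬InBlock c z<B in-c)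
    ... | no _    | yes _    = refl
    ... | no _    | no ¬in-c = ⊥-elim (¬in-c in-c)

    swapBlock-other : ∀ c {z} → ¬ z < B → ¬ InBlock c z → swapBlock c z ≡ z
    swapBlock-other c {z} z≮B ¬in-c with z <? B | inBlock? c z
    ... | yes z<B | _       = ⊥-elim (z≮B z<B)
    ... | no _    | yes in-c = ⊥-elim (¬in-c in-c)
    ... | no _    | no _     = refl

    swapBlock-involutive : ∀ c z → swapBlock c (swapBlock c z) ≡ z
    swapBlock-involutive c z with z <? B | inBlock? c z
    ... | yes z<B | _                      = trans (swapBlock-InBlock c (InBlock-base+ c z<B)) (m+n∸m≡n (base c) z)
    ... | no _    | yes in-c@(base≤z , _) = trans (swapBlock-< c (InBlock-offset c in-c)) (m+[n∸m]≡n base≤z)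
    ... | no z≮B  | no ¬in-c               = swapBlock-other c z≮B ¬in-c

module Relabelling {n : ℕ} (B : ℕ) (n≤B : n ≤ B) where
  open Blocks B

  top : ℕ
  top = base n + B

  Hits : Vec ℕ n → ℕ → Set
  Hits x c = ∃[ j ] InBlock c (lookup x j)

  hits? : ∀ x → Decidable (Hits x)
  hits? x c = any? (λ j → inBlock? c (lookup x j))

  Avoids : Vec ℕ n → ℕ → Set
  Avoids x c = ¬ Hits x c

  some-block-avoided : ∀ x → ¬ (∀ c → c < suc n → Hits x c)
  some-block-avoided x hits with pigeonhole (n<1+n n) (λ c → proj₁ (hits (toℕ c) (toℕ<n c)))
  ... | c , c' , c<c' , same = InBlock-disjoint c<c' (proj₂ (hits (toℕ c) (toℕ<n c)))
    (subst (λ j → InBlock (toℕ c') (lookup x j)) (sym same) (proj₂ (hits (toℕ c') (toℕ<n c'))))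

  freeBlock : Vec ℕ n → ℕ
  freeBlock x = firstFailure (hits? x) (suc n)

  freeBlock-< : ∀ x → freeBlock x < suc n
  freeBlock-< x with m≤n⇒m<n∨m≡n (firstFailure-≤ (hits? x) (suc n))
  ... | inj₁ free<1+n = free<1+n
  ... | inj₂ free≡1+n = ⊥-elim (some-block-avoided x λ c c<1+n →
          firstFailure-below (hits? x) (suc n) c (subst (c <_) (sym free≡1+n) c<1+n))

  freeBlock-avoided : ∀ x → Avoids x (freeBlock x)
  freeBlock-avoided x = firstFailure-fails (hits? x) (suc n) (freeBlock-< x)

  freeBlock-map : ∀ σ → Fixes σ top → ∀ x → freeBlock (map (to σ) x) ≡ freeBlock x
  freeBlock-map σ fixes x = firstFailure-cong (hits? (map (to σ) x)) (hits? x) (suc n) λ c c<1+n → mk⇔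
    (λ (j , in-c) → j , InBlock-unmap (≤-pred c<1+n) (subst (InBlock c) (lookup-map j (to σ) x) in-c))
    (λ (j , in-c) → j , subst (InBlock c) (sym (lookup-map j (to σ) x)) (InBlock-map (≤-pred c<1+n) in-c))
    where
    InBlock-map : ∀ {c z} → c ≤ n → InBlock c z → InBlock c (to σ z)
    InBlock-map {c} c≤n in-c = subst (InBlock c) (sym (fixes _ (InBlock-< c≤n in-c))) in-c
    InBlock-unmap : ∀ {c z} → c ≤ n → InBlock c (to σ z) → InBlock c z
    InBlock-unmap {c} c≤n in-c = subst (InBlock c) (↔-injective σ (fixes _ (InBlock-< c≤n in-c))) in-c

  SlotPoint : Vec ℕ n → ℕ → ℕ → Set
  SlotPoint x c z = base c ≤ z × Slot x (z ∸ base c)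

  SlotPoint-InBlock : ∀ x c {z} → SlotPoint x c z → InBlock c z
  SlotPoint-InBlock x c (base≤z , k<n , _) =
    base≤z , subst (_< base c + B) (m+[n∸m]≡n base≤z) (+-monoʳ-< (base c) (<-≤-trans k<n n≤B))

  entry-¬InBlock : ∀ x c {z} → Avoids x c → firstIndex x z < n → ¬ InBlock c z
  entry-¬InBlock x c {z} avoids found in-c =
    let (j , xⱼ≡nth) = nth-lookup x (firstIndex x z) found in
    avoids (j , subst (InBlock c) (sym (trans xⱼ≡nth (nth-firstIndex x z found))) in-c)

  -- swapSlots x c exchanges base c + k with nth x k for every slot k of x.
  opaque
    swapSlots : Vec ℕ n → ℕ → ℕ → ℕ
    swapSlots x c z with (base c ≤? z) ×-dec slot? x (z ∸ base c) | firstIndex x z <? n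
    ... | yes _ | _     = nth x (z ∸ base c)
    ... | no _  | yes _ = base c + firstIndex x z
    ... | no _  | no _  = z

    swapSlots-slot : ∀ x c {z} → SlotPoint x c z → swapSlots x c z ≡ nth x (z ∸ base c)
    swapSlots-slot x c {z} sp with (base c ≤? z) ×-dec slot? x (z ∸ base c)
    ... | yes _  = refl
    ... | no ¬sp = ⊥-elim (¬sp sp)

    swapSlots-entry : ∀ x c {z} → ¬ SlotPoint x c z → firstIndex x z < n →
      swapSlots x c z ≡ base c + firstIndex x z
    swapSlots-entry x c {z} ¬sp found with (base c ≤? z) ×-dec slot? x (z ∸ base c) | firstIndex x z <? n
    ... | yes sp | _         = ⊥-elim (¬sp sp)
    ... | no _   | yes _     = refl
    ... | no _   | no ¬found = ⊥-elim (¬found found)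

    swapSlots-other : ∀ x c {z} → ¬ SlotPoint x c z → ¬ firstIndex x z < n → swapSlots x c z ≡ z
    swapSlots-other x c {z} ¬sp ¬found with (base c ≤? z) ×-dec slot? x (z ∸ base c) | firstIndex x z <? n
    ... | yes sp | _         = ⊥-elim (¬sp sp)
    ... | no _   | yes found = ⊥-elim (¬found found)
    ... | no _   | no _      = refl

    swapSlots-involutive : ∀ x c → Avoids x c → ∀ z → swapSlots x c (swapSlots x c z) ≡ z
    swapSlots-involutive x c avoids z with (base c ≤? z) ×-dec slot? x (z ∸ base c) | firstIndex x z <? n
    ... | yes (base≤z , k<n , first) | _ =
      trans (swapSlots-entry x c (entry-¬InBlock x c avoids found ∘ SlotPoint-InBlock x c) found)
            (trans (cong (base c +_) first) (m+[n∸m]≡n base≤z))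
      where
      found : firstIndex x (nth x (z ∸ base c)) < n
      found = subst (_< n) (sym first) k<n
    ... | no _ | yes found =
      trans (swapSlots-slot x c (m≤m+n (base c) _ , subst (Slot x) (sym (m+n∸m≡n (base c) _)) slot))
            (trans (cong (nth x) (m+n∸m≡n (base c) _)) (nth-firstIndex x z found))
      where
      slot : Slot x (firstIndex x z)
      slot = found , cong (firstIndex x) (nth-firstIndex x z found)
    ... | no ¬sp | no ¬found = swapSlots-other x c ¬sp ¬found

  swapSlots-base+-slot : ∀ x c {k} → Slot x k → swapSlots x c (base c + k) ≡ nth x k
  swapSlots-base+-slot x c {k} slot =
    trans (swapSlots-slot x c (m≤m+n (base c) k , subst (Slot x) (sym (m+n∸m≡n (base c) k)) slot))
          (cong (nth x) (m+n∸m≡n (base c) k))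

  swapSlots-base+-fixed : ∀ x c {k} → Avoids x c → k < B → ¬ Slot x k →
    swapSlots x c (base c + k) ≡ base c + k
  swapSlots-base+-fixed x c {k} avoids k<B ¬slot = swapSlots-other x c
    (λ (_ , slot) → ¬slot (subst (Slot x) (m+n∸m≡n (base c) k) slot))
    (λ found → entry-¬InBlock x c avoids found (InBlock-base+ c k<B))

  swapSlots-commutes : ∀ σ → Fixes σ top → ∀ x c → c ≤ n → Avoids x c → Avoids (map (to σ) x) c →
    ∀ {k} → k < B → to σ (swapSlots x c (base c + k)) ≡ swapSlots (map (to σ) x) c (base c + k)
  swapSlots-commutes σ fixes x c c≤n avoids avoids' {k} k<B with slot? x k
  ... | yes slot@(k<n , first) = begin
    to σ (swapSlots x c (base c + k))       ≡⟨ cong (to σ) (swapSlots-base+-slot x c slot) ⟩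
    to σ (nth x k)                          ≡⟨ nth-map (to σ) x k k<n ⟨
    nth σx k                                ≡⟨ swapSlots-base+-slot σx c σslot ⟨
    swapSlots σx c (base c + k)             ∎
    where
    open ≡-Reasoning
    σx    = map (to σ) x
    σslot = k<n , trans (firstIndex-nth-map (↔-injective σ) x k k<n) first
  ... | no ¬slot = begin
    to σ (swapSlots x c (base c + k))       ≡⟨ cong (to σ) (swapSlots-base+-fixed x c avoids k<B ¬slot) ⟩
    to σ (base c + k)                       ≡⟨ fixes _ (InBlock-< c≤n (InBlock-base+ c k<B)) ⟩
    base c + k                              ≡⟨ swapSlots-base+-fixed σx c avoids' k<B ¬σslot ⟨
    swapSlots σx c (base c + k)             ∎
    where
    open ≡-Reasoning
    σx     = map (to σ) x
    ¬σslot = λ (k<n , first) → ¬slot (k<n , trans (sym (firstIndex-nth-map (↔-injective σ) x k k<n)) first)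

  θ : Vec ℕ n → ℕ ↔ ℕ
  θ x = involution (swapSlots x (freeBlock x)) (swapSlots-involutive x (freeBlock x) (freeBlock-avoided x))
      ↔-∘ involution (swapBlock (freeBlock x)) (swapBlock-involutive (freeBlock x))

  θ-equalityPattern : ∀ x j → to (θ x) (lookup (equalityPattern x) j) ≡ lookup x j
  θ-equalityPattern x j = begin
    to (θ x) (lookup (equalityPattern x) j) ≡⟨ cong (to (θ x)) (lookup-map j (firstIndex x) x) ⟩
    swapSlots x c (swapBlock c k)           ≡⟨ cong (swapSlots x c) (swapBlock-< c k<B) ⟩
    swapSlots x c (base c + k)              ≡⟨ swapSlots-base+-slot x c (firstIndex-Slot x j) ⟩
    nth x k                                 ≡⟨ nth-firstIndex x _ (firstIndex-lookup x j) ⟩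
    lookup x j                              ∎
    where
    open ≡-Reasoning
    c   = freeBlock x
    k   = firstIndex x (lookup x j)
    k<B = <-≤-trans (firstIndex-lookup x j) n≤B

  θ-commutes : ∀ σ → Fixes σ top → ∀ x {z} → z < B → to σ (to (θ x) z) ≡ to (θ (map (to σ) x)) z
  θ-commutes σ fixes x {z} z<B = begin
    to σ (swapSlots x c (swapBlock c z)) ≡⟨ cong (to σ ∘ swapSlots x c) (swapBlock-< c z<B) ⟩
    to σ (swapSlots x c (base c + z))    ≡⟨ swapSlots-commutes σ fixes x c c≤n (freeBlock-avoided x) avoids' z<B ⟩
    swapSlots σx c (base c + z)          ≡⟨ cong (swapSlots σx c) (swapBlock-< c z<B) ⟨
    swapSlots σx c (swapBlock c z)       ≡⟨ cong (λ c' → swapSlots σx c' (swapBlock c' z)) same-block ⟨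
    to (θ σx) z                          ∎
    where
    open ≡-Reasoning
    σx         = map (to σ) x
    c          = freeBlock x
    c≤n        = ≤-pred (freeBlock-< x)
    same-block = freeBlock-map σ fixes x
    avoids'    = subst (Avoids σx) same-block (freeBlock-avoided σx)

module FinitelySupported where
  open Assignment

  SupportedBy : ∀ {k} → ℕ → Pred ℕ k → Set
  SupportedBy N P = ∀ π → Fixes π N → ∀ v → P (map (to π) v) ≡ P v

  M₂ : PredStructure
  M₂ = record
    { J₀  = ℕ
    ; j₀  = 0
    ; J   = λ k P → ∃[ N ] SupportedBy N P
    ; Jne = λ k → (λ _ → true) , 0 , λ _ _ _ → refl
    }

  support : ∀ {k} → JElt M₂ k → ℕ
  support = proj₁ ∘ proj₂

  JElt-supported : ∀ {k N} (P : JElt M₂ k) → support P ≤ N → SupportedBy N (proj₁ P)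
  JElt-supported (_ , _ , supp) ≤N π fixes = supp π (λ z z<N → fixes z (<-≤-trans z<N ≤N))

  -- π'⁻¹ ∘ σ ∘ π fixes [0, N), so it does not affect P.
  SupportedBy-conjugate : ∀ {k N} {P : Pred ℕ k} → SupportedBy N P → ∀ (π π' σ : ℕ ↔ ℕ) →
    (∀ z → z < N → to σ (to π z) ≡ to π' z) →
    ∀ v → P (map (from π') (map (to σ) v)) ≡ P (map (from π) v)
  SupportedBy-conjugate {P = P} supp π π' σ σπ≗π' v = trans (cong P relabel) (supp χ χ-fixes (map (from π) v))
    where
    χ : ℕ ↔ ℕ
    χ = ↔-sym π' ↔-∘ (σ ↔-∘ π)
    χ-fixes : Fixes χ _
    χ-fixes z z<N = trans (cong (from π') (σπ≗π' z z<N)) (strictlyInverseʳ π' z)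
    relabel : map (from π') (map (to σ) v) ≡ map (to χ) (map (from π) v)
    relabel = begin
      map (from π') (map (to σ) v)           ≡⟨ map-∘ (from π') (to σ) v ⟨
      map (from π' ∘ to σ) v                 ≡⟨ map-cong (cong (from π' ∘ to σ) ∘ sym ∘ strictlyInverseˡ π) v ⟩
      map (from π' ∘ to σ ∘ to π ∘ from π) v ≡⟨ map-∘ (to χ) (from π) v ⟩
      map (to χ) (map (from π) v)            ∎
      where open ≡-Reasoning

  automorphism : ℕ ↔ ℕ → Automorphism M₂
  automorphism π = record
    { bijection = π
    ; image     = λ P → relabel P π , λ v → cong (proj₁ P) (map-from-to v)
    ; preimage  = λ Q → relabel Q (↔-sym π) , λ v → refl
    }
    where
    image-bound : ℕ ↔ ℕ → ℕ → ℕ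
    image-bound τ N = suc (proj₁ (bounded-below (to τ) N))
    relabel : ∀ {k} → JElt M₂ k → ℕ ↔ ℕ → JElt M₂ k
    relabel (P , N , supp) τ = (λ v → P (map (from τ) v)) , image-bound τ N , λ σ fixes →
      SupportedBy-conjugate supp τ τ σ λ z z<N → fixes (to τ z) (s≤s (proj₂ (bounded-below (to τ) N) z z<N))
    map-from-to : ∀ {k} (v : Vec ℕ k) → map (from π) (map (to π) v) ≡ v
    map-from-to v = trans (sym (map-∘ (from π) (to π) v)) (trans (map-cong (strictlyInverseʳ π) v) (map-id v))

  ParametersBelow : Assignment M₂ → Formula → ℕ → Set
  ParametersBelow ρ φ N =
    (∀ i → FreeI i φ → ind ρ i < N) × (∀ k i → FreeP k i φ → support (prd ρ k i) ≤ N)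

  parameters-join : ∀ φ ψ ρ → ∃[ N ] ParametersBelow ρ φ N → ∃[ N ] ParametersBelow ρ ψ N →
    ∃[ N ] ParametersBelow ρ (φ ∧' ψ) N
  parameters-join φ ψ ρ (N , bi , bp) (N' , bi' , bp') = N ⊔ N' ,
    (λ { i (inj₁ free) → <-≤-trans (bi i free) (m≤m⊔n N N')
       ; i (inj₂ free) → <-≤-trans (bi' i free) (m≤n⊔m N N') }) ,
    (λ { k i (inj₁ free) → ≤-trans (bp k i free) (m≤m⊔n N N')
       ; k i (inj₂ free) → ≤-trans (bp' k i free) (m≤n⊔m N N') })

  parameters-bounded : ∀ φ ρ → ∃[ N ] ParametersBelow ρ φ N
  parameters-bounded (eqI a b) ρ = suc (ind ρ a ⊔ ind ρ b) ,
    (λ { _ (inj₁ refl) → s≤s (m≤m⊔n _ _) ; _ (inj₂ refl) → s≤s (m≤n⊔m _ _) }) , λ _ _ ()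
  parameters-bounded (eqP k a b) ρ = support (prd ρ k a) ⊔ support (prd ρ k b) , (λ _ ()) ,
    λ { _ _ (inj₁ (refl , refl)) → m≤m⊔n _ _ ; _ _ (inj₂ (refl , refl)) → m≤n⊔m _ _ }
  parameters-bounded (atom k a xs) ρ = N ⊔ support (prd ρ k a) ,
    (λ { _ (j , refl) → <-≤-trans (subst (_< N) (lookup-map j (ind ρ) xs) (below j)) (m≤m⊔n _ _) }) ,
    λ { _ _ (refl , refl) → m≤n⊔m _ _ }
    where
    N     = proj₁ (entries-bounded (map (ind ρ) xs))
    below = proj₂ (entries-bounded (map (ind ρ) xs))
  parameters-bounded (¬' φ)     ρ = parameters-bounded φ ρ
  parameters-bounded (φ ∧' ψ)   ρ = parameters-join φ ψ ρ (parameters-bounded φ ρ) (parameters-bounded ψ ρ)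
  parameters-bounded (φ ∨' ψ)   ρ = parameters-join φ ψ ρ (parameters-bounded φ ρ) (parameters-bounded ψ ρ)
  parameters-bounded (φ ⇒' ψ)   ρ = parameters-join φ ψ ρ (parameters-bounded φ ρ) (parameters-bounded ψ ρ)
  parameters-bounded (φ ⇔' ψ)   ρ = parameters-join φ ψ ρ (parameters-bounded φ ρ) (parameters-bounded ψ ρ)
  parameters-bounded (∀i x φ)   ρ = let (N , bi , bp) = parameters-bounded φ ρ in N , (λ i → bi i ∘ proj₂) , bp
  parameters-bounded (∃i x φ)   ρ = let (N , bi , bp) = parameters-bounded φ ρ in N , (λ i → bi i ∘ proj₂) , bp
  parameters-bounded (∀p k a φ) ρ = let (N , bi , bp) = parameters-bounded φ ρ in N , bi , (λ l i → bp l i ∘ proj₂)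
  parameters-bounded (∃p k a φ) ρ = let (N , bi , bp) = parameters-bounded φ ρ in N , bi , (λ l i → bp l i ∘ proj₂)

  characteristic-supported : ∀ (em : ExcludedMiddle 0ℓ) ρ {k} (xs : Vec ℕ (suc k)) H {N} →
    ParametersBelow ρ H N → SupportedBy N (characteristic M₂ em ρ xs H)
  characteristic-supported em ρ xs H (bi , bp) σ fixes v =
    does-⇔ (⇔-sym (Sat-transport M₂ (automorphism σ) H _ _ (ai , ap))) em em
    where
    ai : ∀ i → FreeI i H → ind (updI* M₂ ρ xs (map (to σ) v)) i ≡ to σ (ind (updI* M₂ ρ xs v) i)
    ai i free = ind-updI*-image M₂ (to σ) ρ ρ xs v _ i
      (λ j → lookup-map j (to σ) v) (λ _ → sym (fixes _ (bi i free)))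
    ap : ∀ k i → FreeP k i H → ImageUnder M₂ (to σ) (proj₁ (prd (updI* M₂ ρ xs v) k i))
                                                   (proj₁ (prd (updI* M₂ ρ xs (map (to σ) v)) k i))
    ap k i free w rewrite prd-updI* M₂ ρ xs (map (to σ) v) | prd-updI* M₂ ρ xs v =
      JElt-supported (prd ρ k i) (bp k i free) σ fixes w

  M₂-henkin : ExcludedMiddle 0ℓ → IsHenkin M₂
  M₂-henkin em = definable⇒Henkin M₂ em λ ρ k xs H →
    let (N , below) = parameters-bounded H ρ in N , characteristic-supported em ρ xs H below

  -- A binary predicate supported by [0, N) cannot tell N and N + 1 apart, so it does not order them.
  M₂-¬WO¹ : Holds M₂ (¬' WO¹)
  M₂-¬WO¹ ρ wo with wo ((λ _ → true) , 0 , λ _ _ _ → refl)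
  ... | (T , N , supp) , (_ , irreflexive , transitive , total) , _ =
    [ ordered , [ 1+n≢n ∘ sym , ordered ∘ trans (sym symmetric) ]′ ]′ (total N (suc N) (refl , refl))
    where
    τ = involution (transpose N (suc N)) (transpose-involutive N (suc N))
    τ-fixes : Fixes τ N
    τ-fixes z z<N = transpose-other N (suc N) z (<⇒≢ z<N) (<⇒≢ (m<n⇒m<1+n z<N))
    symmetric : T (suc N ∷ N ∷ []) ≡ T (N ∷ suc N ∷ [])
    symmetric = trans (cong T (sym swapped)) (supp τ τ-fixes (N ∷ suc N ∷ []))
      where swapped = cong₂ (λ p q → p ∷ q ∷ []) (transpose-p N (suc N)) (transpose-q N (suc N))
    ordered : T (N ∷ suc N ∷ []) ≡ true → ⊥
    ordered e = irreflexive N (transitive N (suc N) N (e , trans symmetric e))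

  module Uniformize {a b} (W : Vec ℕ (suc a) → JElt M₂ b → Set) (W-invariant : Invariant M₂ W)
    (total : ∀ x → Σ (JElt M₂ b) (W x)) {B} (a<B : suc a ≤ B)
    (bounded : ∀ p → (∀ j → lookup p j < suc a) → support (proj₁ (total p)) ≤ B) where

    open Relabelling B a<B

    D : Vec ℕ (suc a) → JElt M₂ b
    D p = proj₁ (total p)

    D-supported : ∀ x → SupportedBy B (proj₁ (D (equalityPattern x)))
    D-supported x = JElt-supported (D (equalityPattern x)) (bounded _ (equalityPattern-< x))

    F : Vec ℕ (suc a) → JElt M₂ b
    F x = proj₁ (Automorphism.image (automorphism (θ x)) (D (equalityPattern x)))

    F-witness : ∀ x → W x (F x)
    F-witness x = W-invariant (automorphism (θ x)) {equalityPattern x} {x} {D (equalityPattern x)} {F x}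
      (λ j → sym (θ-equalityPattern x j))
      (proj₂ (Automorphism.image (automorphism (θ x)) (D (equalityPattern x))))
      (proj₂ (total (equalityPattern x)))

    glue-supported : SupportedBy top (glue M₂ F)
    glue-supported σ fixes v = subst (λ v → glue M₂ F (map (to σ) v) ≡ glue M₂ F v)
      (take++drop≡id (suc a) v) (on-++ (take (suc a) v) (drop (suc a) v))
      where
      on-++ : ∀ x y → glue M₂ F (map (to σ) (x ++ y)) ≡ glue M₂ F (x ++ y)
      on-++ x y = begin
        glue M₂ F (map (to σ) (x ++ y))                       ≡⟨ cong (glue M₂ F) (map-++ (to σ) x y) ⟩
        glue M₂ F (σx ++ σy)                                  ≡⟨ glue-++ M₂ F σx σy ⟩
        proj₁ (D (equalityPattern σx)) (map (from (θ σx)) σy) ≡⟨ cong (λ p → proj₁ (D p) (map (from (θ σx)) σy))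
                                                                   (equalityPattern-map (↔-injective σ) x) ⟩
        proj₁ (D (equalityPattern x)) (map (from (θ σx)) σy)  ≡⟨ SupportedBy-conjugate (D-supported x) (θ x) (θ σx) σ
                                                                   (λ _ → θ-commutes σ fixes x) y ⟩
        proj₁ (D (equalityPattern x)) (map (from (θ x)) y)    ≡⟨ glue-++ M₂ F x y ⟨
        glue M₂ F (x ++ y)                                    ∎
        where
        open ≡-Reasoning
        σx = map (to σ) x
        σy = map (to σ) y

  M₂-uniformization : ∀ a b → Uniformization M₂ a b
  M₂-uniformization a b W W-invariant total = F , F-witness , _ , glue-supported
    where
    bound = bounded-on-box (suc a) (suc a) (support ∘ proj₁ ∘ total)
    open Uniformize W W-invariant total (m≤m⊔n (suc a) (proj₁ bound))
      (λ p p<a → ≤-trans (proj₂ bound p p<a) (m≤n⊔m (suc a) (proj₁ bound)))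

open OnePoint
open FinitelySupported

-- ChoiceH n m is empty when n or m is 0.
theorem4p1 : ExcludedMiddle 0ℓ → (n m : ℕ) → 1 ≤ n → 1 ≤ m →
    (Σ[ M ∈ PredStructure ] IsHenkin M × ModelOf M (ChoiceH n m ∪｛ WO¹ ｝))
    × (Σ[ M ∈ PredStructure ] IsHenkin M × ModelOf M (ChoiceH n m ∪｛ ¬' WO¹ ｝))
theorem4p1 em n m _ _ =
  (M₁ , M₁-henkin em , models-∪ M₁ (uniformization⇒choiceH M₁ M₁-uniformization n m) M₁-WO¹) ,
  (M₂ , M₂-henkin em , models-∪ M₂ (uniformization⇒choiceH M₂ M₂-uniformization n m) M₂-¬WO¹)
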